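{- Let $p$ be a prime and $G$ a $p$-group such that $\alpha(\mathcal{G}(G))<\infty$. Then either $G$ is finite or $G\cong C_{p^\infty}$.
   Context: A $p$-group is a group in which every element has order a power of $p$. The power graph $\mathcal{G}(G)$ has vertex set $G$, two distinct elements adjacent iff one is a power of the other; $\alpha$ denotes the independence number. $C_{p^\infty}$ is the $p$-quasicyclic (Prüfer) group. -}

module Defs where

open import Level using (Level; _⊔_) renaming (suc to lsuc; zero to lzero)
open import Data.Nat as ℕ using (ℕ; zero; suc; _≤_; _<_)
open import Data.Integer as ℤ using (ℤ; +_; -[1+_])
open import Data.Integer.Divisibility using () renaming (_∣_ to _∣ℤ_)
open import Data.Product using (Σ; ∃; _×_; _,_)
open import Data.Fin using (Fin)
open import Data.List using (List; length)
open import Data.List.Relation.Unary.AllPairs using (AllPairs)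
open import Data.Sum using (_⊎_)
open import Relation.Nullary using (¬_)
open import Algebra.Bundles using (Group; RawGroup)
open import Algebra.Morphism.Structures using (module GroupMorphisms)

module _ {c ℓ : Level} (G : Group c ℓ) where
  open Group G

  pow : Carrier → ℕ → Carrier
  pow x zero    = ε
  pow x (suc n) = x ∙ pow x n

  zpow : Carrier → ℤ → Carrier
  zpow x (+ n)      = pow x n
  zpow x -[1+ n ]   = (pow x (suc n)) ⁻¹

  HasOrder : Carrier → ℕ → Set ℓ
  HasOrder x m = (0 < m) × (pow x m ≈ ε) × (∀ n → 0 < n → pow x n ≈ ε → m ≤ n)

  IsPGroup : ℕ → Set (c ⊔ ℓ)
  IsPGroup p = ∀ x → ∃ λ k → HasOrder x (p ℕ.^ k)

  PowerAdj : Carrier → Carrier → Set ℓ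
  PowerAdj x y = ¬ (x ≈ y) × ((∃ λ z → y ≈ zpow x z) ⊎ (∃ λ z → x ≈ zpow y z))

  IsIndependent : List Carrier → Set (c ⊔ ℓ)
  IsIndependent xs = AllPairs (λ x y → ¬ (x ≈ y) × ¬ PowerAdj x y) xs

  FiniteIndependenceNumber : Set (c ⊔ ℓ)
  FiniteIndependenceNumber =
    ∃ λ (N : ℕ) → ∀ (xs : List Carrier) → IsIndependent xs → length xs ≤ N

  IsFinite : Set (c ⊔ ℓ)
  IsFinite = ∃ λ (n : ℕ) → Σ (Fin n → Carrier) λ f → ∀ x → ∃ λ i → f i ≈ x

-- The Prüfer group C_{p^∞}, realised as ℤ[1/p]/ℤ.
-- The pair (k , a) stands for the class of a / p^k modulo ℤ.

module _ (p : ℕ) where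

  PrüferCarrier : Set
  PrüferCarrier = ℕ × ℤ

  -- a/p^k ≡ b/p^l (mod ℤ)  iff  p^(k+l) ∣ a·p^l − b·p^k
  _≈ᴾ_ : PrüferCarrier → PrüferCarrier → Set
  (k , a) ≈ᴾ (l , b) =
    (+ (p ℕ.^ (k ℕ.+ l))) ∣ℤ ((a ℤ.* + (p ℕ.^ l)) ℤ.- (b ℤ.* + (p ℕ.^ k)))

  _+ᴾ_ : PrüferCarrier → PrüferCarrier → PrüferCarrier
  (k , a) +ᴾ (l , b) = (k ℕ.+ l , (a ℤ.* + (p ℕ.^ l)) ℤ.+ (b ℤ.* + (p ℕ.^ k)))

  0ᴾ : PrüferCarrier
  0ᴾ = (0 , + 0)

  -ᴾ_ : PrüferCarrier → PrüferCarrier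
  -ᴾ (k , a) = (k , ℤ.- a)

  Prüfer : RawGroup lzero lzero
  Prüfer = record
    { Carrier = PrüferCarrier
    ; _≈_     = _≈ᴾ_
    ; _∙_     = _+ᴾ_
    ; ε       = 0ᴾ
    ; _⁻¹     = -ᴾ_
    }

_≅Prüfer_ : {c ℓ : Level} → Group c ℓ → ℕ → Set (c ⊔ ℓ)
G ≅Prüfer p = ∃ λ (f : Group.Carrier G → PrüferCarrier p) →
  GroupMorphisms.IsGroupIsomorphism (Group.rawGroup G) (Prüfer p) f

{-# OPTIONS --safe #-}

-- Write x ∈⟨ y ⟩ when x is a power of y.  A maximal independent set of the power graph among the
-- elements of order p ^ k has at most N members, and each element of order p ^ k generates the same
-- cyclic subgroup as one of them; so there are at most N p ^ k such elements, and G is finite when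
-- its exponent is bounded.  Otherwise ∈⟨⟩ is total: if x ∉ ⟨z⟩ with z of huge order, two of the
-- conjugates of x by z ^ 0, …, z ^ (N p ^ k) coincide, so x commutes with a small power w of z, still
-- of large order, and the elements x ∙ w ^ (p ^ (n − s)) form an antichain of size N + 1 in the
-- power graph.  A totally ordered p-group of unbounded exponent has a coherent sequence g k of
-- elements of order p ^ k with g k = g (k + 1) ^ p, and (k , a) ↦ g k ^ a identifies it with the
-- Prüfer group.

module Submission where

open import Defs hiding (pow; zpow)
import Defs
open import Level using (Level; _⊔_)
open import Function using (_∘_; id)
open import Data.Nat as ℕ using (ℕ; zero; suc; _+_; _*_; _∸_; _^_; _≤_; _<_; z≤n; s≤s; s≤s⁻¹; z<s; NonZero; >-nonZero)
open import Data.Nat.Properties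
open import Data.Nat.Divisibility
open import Data.Nat.DivMod using (_%_; _/_; m≡m%n+[m/n]*n; m%n<n)
open import Data.Nat.Coprimality using (Coprime; coprime-Bézout; coprime-divisor)
open import Data.Nat.GCD using (module Bézout)
open import Data.Nat.Primality using (Prime; prime⇒irreducible; prime⇒nonZero; prime⇒nonTrivial)
open import Data.Nat.Tactic.RingSolver using (solve-∀)
open import Data.Integer as ℤ using (ℤ; +_; -[1+_]; _⊖_)
open import Data.Integer.Properties as ℤP using (⊖-≥; ⊖-<; [1+m]⊖[1+n]≡m⊖n; pos-*; neg-distribˡ-*)
open import Data.Fin using (Fin; toℕ; fromℕ<; _↑ˡ_; _↑ʳ_; splitAt; combine; remQuot)
open import Data.Fin.Properties using (splitAt-↑ˡ; splitAt-↑ʳ; remQuot-combine; toℕ-fromℕ<; pigeonhole; toℕ<n)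
open import Data.List using ([]; _∷_; length; lookup; applyUpTo)
open import Data.List.Properties using (length-applyUpTo)
open import Data.List.Relation.Unary.All using (All; []; _∷_; lookupAny)
open import Data.List.Relation.Unary.All.Properties.Core using (¬All⇒Any¬)
open import Data.List.Relation.Unary.Any as Any using (Any)
open import Data.List.Relation.Unary.AllPairs using (AllPairs; []; _∷_)
open import Data.List.Relation.Unary.AllPairs.Properties using (applyUpTo⁺₁)
open import Data.Product using (Σ; ∃; _×_; _,_; proj₁; proj₂; uncurry)
open import Data.Sum using (_⊎_; inj₁; inj₂; [_,_]′)
open import Data.Empty using (⊥; ⊥-elim)
open import Relation.Nullary using (¬_; yes; no)
open import Relation.Binary.Bundles using (Setoid)
open import Relation.Binary.PropositionalEquality as ≡ using (_≡_)
open import Algebra.Bundles using (Group; RawGroup)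
open import Algebra.Morphism.Structures using (module GroupMorphisms)
import Algebra.Properties.Group as GroupProperties
import Algebra.Properties.Monoid.Mult as MonoidMult
import Algebra.Properties.Quasigroup as QuasigroupProperties
open import Axiom.ExcludedMiddle using (ExcludedMiddle)

module _ {a r} {A : Set a} (R : A → A → Set r) (lem : ∀ {ℓ} → ExcludedMiddle ℓ) where

  -- Greedy extension: a list can only grow N times before the bound is violated.
  maximal-AllPairs : ∀ {p} (N : ℕ) → (∀ xs → AllPairs R xs → length xs ≤ N) → (P : A → Set p) →
    ∃ λ L → All P L × AllPairs R L × (∀ x → P x → Any (λ l → ¬ R x l) L)
  maximal-AllPairs N bound P = grow N [] (m≤m+n N 0) [] []
    where
    grow : ∀ fuel L → N ≤ fuel + length L → All P L → AllPairs R L →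
           ∃ λ L → All P L × AllPairs R L × (∀ x → P x → Any (λ l → ¬ R x l) L)
    grow fuel L N≤ PL RL with lem {P = ∃ λ x → P x × All (R x) L}
    ... | no ¬extend = L , PL , RL , λ x Px → ¬All⇒Any¬ (λ _ → lem) L (λ Rx → ¬extend (x , Px , Rx))
    grow zero L N≤ PL RL | yes (x , Px , Rx) = ⊥-elim (1+n≰n (≤-trans (bound (x ∷ L) (Rx ∷ RL)) N≤))
    grow (suc fuel) L N≤ PL RL | yes (x , Px , Rx) =
      grow fuel (x ∷ L) (≡.subst (N ≤_) (≡.sym (+-suc fuel (length L))) N≤) (Px ∷ PL) (Rx ∷ RL)

module Powers {c ℓ} (G : Group c ℓ) where
  open Group G
  open MonoidMult monoid using (×-congʳ; ×-homo-+; ×-assocˡ) renaming (_×_ to _×ᴹ_)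
  open import Relation.Binary.Reasoning.Setoid setoid

  pow : Carrier → ℕ → Carrier
  pow = Defs.pow G

  pow≡× : ∀ x n → pow x n ≡ n ×ᴹ x
  pow≡× x zero    = ≡.refl
  pow≡× x (suc n) = ≡.cong (x ∙_) (pow≡× x n)

  pow-congˡ : ∀ {x y} n → x ≈ y → pow x n ≈ pow y n
  pow-congˡ {x} {y} n x≈y rewrite pow≡× x n | pow≡× y n = ×-congʳ n x≈y

  pow-congʳ : ∀ x {m n} → m ≡ n → pow x m ≈ pow x n
  pow-congʳ x ≡.refl = refl

  pow-+ : ∀ x m n → pow x (m + n) ≈ pow x m ∙ pow x n
  pow-+ x m n rewrite pow≡× x (m + n) | pow≡× x m | pow≡× x n = ×-homo-+ x m n

  pow-* : ∀ x m n → pow x (m * n) ≈ pow (pow x n) m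
  pow-* x m n rewrite pow≡× x (m * n) | pow≡× (pow x n) m | pow≡× x n = sym (×-assocˡ x m n)

  pow-*′ : ∀ x m n → pow x (m * n) ≈ pow (pow x m) n
  pow-*′ x m n = trans (pow-congʳ x (*-comm m n)) (pow-* x n m)

  pow-1 : ∀ x → pow x 1 ≈ x
  pow-1 = identityʳ

  pow-suc′ : ∀ x n → pow x (suc n) ≈ pow x n ∙ x
  pow-suc′ x n = trans (pow-congʳ x (+-comm 1 n)) (trans (pow-+ x n 1) (∙-congˡ (pow-1 x)))

  pow-ε : ∀ n → pow ε n ≈ ε
  pow-ε zero    = refl
  pow-ε (suc n) = trans (identityˡ _) (pow-ε n)

  pow-swap : ∀ x m n → pow (pow x m) n ≈ pow (pow x n) m
  pow-swap x m n = trans (sym (pow-* x n m)) (trans (pow-congʳ x (*-comm n m)) (pow-* x m n))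

  pow-comm : ∀ x m n → pow x m ∙ pow x n ≈ pow x n ∙ pow x m
  pow-comm x m n = trans (sym (pow-+ x m n)) (trans (pow-congʳ x (+-comm m n)) (pow-+ x n m))

  Commute : Carrier → Carrier → Set ℓ
  Commute x y = x ∙ y ≈ y ∙ x

  commute-pow : ∀ {x y} → Commute x y → ∀ n → Commute x (pow y n)
  commute-pow {x} {y} xy zero    = trans (identityʳ x) (sym (identityˡ x))
  commute-pow {x} {y} xy (suc n) = begin
    x ∙ (y ∙ pow y n) ≈⟨ sym (assoc _ _ _) ⟩
    (x ∙ y) ∙ pow y n ≈⟨ ∙-congʳ xy ⟩
    (y ∙ x) ∙ pow y n ≈⟨ assoc _ _ _ ⟩
    y ∙ (x ∙ pow y n) ≈⟨ ∙-congˡ (commute-pow xy n) ⟩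
    y ∙ (pow y n ∙ x) ≈⟨ sym (assoc _ _ _) ⟩
    (y ∙ pow y n) ∙ x ∎

  pow-∙-commute : ∀ {x y} → Commute x y → ∀ n → pow (x ∙ y) n ≈ pow x n ∙ pow y n
  pow-∙-commute {x} {y} xy zero    = sym (identityˡ ε)
  pow-∙-commute {x} {y} xy (suc n) = begin
    (x ∙ y) ∙ pow (x ∙ y) n     ≈⟨ ∙-congˡ (pow-∙-commute xy n) ⟩
    (x ∙ y) ∙ (pow x n ∙ pow y n) ≈⟨ assoc _ _ _ ⟩
    x ∙ (y ∙ (pow x n ∙ pow y n)) ≈⟨ ∙-congˡ (sym (assoc _ _ _)) ⟩
    x ∙ ((y ∙ pow x n) ∙ pow y n) ≈⟨ ∙-congˡ (∙-congʳ (commute-pow (sym xy) n)) ⟩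
    x ∙ ((pow x n ∙ y) ∙ pow y n) ≈⟨ ∙-congˡ (assoc _ _ _) ⟩
    x ∙ (pow x n ∙ (y ∙ pow y n)) ≈⟨ sym (assoc _ _ _) ⟩
    (x ∙ pow x n) ∙ (y ∙ pow y n) ∎

  ∙⁻¹∙-cancel : ∀ x g → x ∙ g ⁻¹ ∙ g ≈ x
  ∙⁻¹∙-cancel x g = trans (assoc _ _ _) (trans (∙-congˡ (inverseˡ g)) (identityʳ x))

  ∙∙⁻¹-cancel : ∀ x g → x ∙ g ∙ g ⁻¹ ≈ x
  ∙∙⁻¹-cancel x g = trans (assoc _ _ _) (trans (∙-congˡ (inverseʳ g)) (identityʳ x))

  commute-⁻¹ : ∀ {x y} → Commute x y → Commute x (y ⁻¹)
  commute-⁻¹ {x} {y} xy = sym (begin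
    y ⁻¹ ∙ x                ≈⟨ ∙-congˡ (sym (∙∙⁻¹-cancel x y)) ⟩
    y ⁻¹ ∙ (x ∙ y ∙ y ⁻¹)   ≈⟨ ∙-congˡ (∙-congʳ xy) ⟩
    y ⁻¹ ∙ (y ∙ x ∙ y ⁻¹)   ≈⟨ sym (assoc _ _ _) ⟩
    y ⁻¹ ∙ (y ∙ x) ∙ y ⁻¹   ≈⟨ ∙-congʳ (sym (assoc _ _ _)) ⟩
    y ⁻¹ ∙ y ∙ x ∙ y ⁻¹     ≈⟨ ∙-congʳ (∙-congʳ (inverseˡ y)) ⟩
    ε ∙ x ∙ y ⁻¹            ≈⟨ ∙-congʳ (identityˡ x) ⟩
    x ∙ y ⁻¹                ∎)

module Conjugation {c ℓ} (G : Group c ℓ) where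
  open Group G
  open GroupProperties G using (⁻¹-anti-homo-∙; quasigroup)
  open Powers G
  open import Relation.Binary.Reasoning.Setoid setoid

  conj : Carrier → Carrier → Carrier
  conj g x = g ∙ x ∙ g ⁻¹

  conj-homo-∙ : ∀ g x y → conj g (x ∙ y) ≈ conj g x ∙ conj g y
  conj-homo-∙ g x y = begin
    g ∙ (x ∙ y) ∙ g ⁻¹                 ≈⟨ ∙-congʳ (∙-congˡ (∙-congʳ (sym (identityʳ x)))) ⟩
    g ∙ ((x ∙ ε) ∙ y) ∙ g ⁻¹           ≈⟨ ∙-congʳ (∙-congˡ (∙-congʳ (∙-congˡ (sym (inverseˡ g))))) ⟩
    g ∙ ((x ∙ (g ⁻¹ ∙ g)) ∙ y) ∙ g ⁻¹  ≈⟨ ∙-congʳ (sym (assoc _ _ _)) ⟩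
    (g ∙ (x ∙ (g ⁻¹ ∙ g))) ∙ y ∙ g ⁻¹  ≈⟨ ∙-congʳ (∙-congʳ (sym (assoc _ _ _))) ⟩
    ((g ∙ x) ∙ (g ⁻¹ ∙ g)) ∙ y ∙ g ⁻¹  ≈⟨ ∙-congʳ (∙-congʳ (sym (assoc _ _ _))) ⟩
    (g ∙ x ∙ g ⁻¹) ∙ g ∙ y ∙ g ⁻¹      ≈⟨ ∙-congʳ (assoc _ _ _) ⟩
    (g ∙ x ∙ g ⁻¹) ∙ (g ∙ y) ∙ g ⁻¹    ≈⟨ assoc _ _ _ ⟩
    (g ∙ x ∙ g ⁻¹) ∙ (g ∙ y ∙ g ⁻¹)    ∎

  conj-ε : ∀ g → conj g ε ≈ ε
  conj-ε g = trans (∙-congʳ (identityʳ g)) (inverseʳ g)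

  conj-pow : ∀ g x n → pow (conj g x) n ≈ conj g (pow x n)
  conj-pow g x zero    = sym (conj-ε g)
  conj-pow g x (suc n) = trans (∙-congˡ (conj-pow g x n)) (sym (conj-homo-∙ g x (pow x n)))

  conj-∙ : ∀ g h x → conj (g ∙ h) x ≈ conj g (conj h x)
  conj-∙ g h x = begin
    (g ∙ h) ∙ x ∙ (g ∙ h) ⁻¹        ≈⟨ ∙-congˡ (⁻¹-anti-homo-∙ g h) ⟩
    (g ∙ h) ∙ x ∙ (h ⁻¹ ∙ g ⁻¹)     ≈⟨ sym (assoc _ _ _) ⟩
    (g ∙ h) ∙ x ∙ h ⁻¹ ∙ g ⁻¹       ≈⟨ ∙-congʳ (∙-congʳ (assoc _ _ _)) ⟩
    g ∙ (h ∙ x) ∙ h ⁻¹ ∙ g ⁻¹       ≈⟨ ∙-congʳ (assoc _ _ _) ⟩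
    g ∙ (h ∙ x ∙ h ⁻¹) ∙ g ⁻¹       ∎

  conj-injective : ∀ g {x y} → conj g x ≈ conj g y → x ≈ y
  conj-injective g {x} {y} e = cancelˡ g x y (cancelʳ (g ⁻¹) (g ∙ x) (g ∙ y) e)
    where open QuasigroupProperties quasigroup using (cancelˡ; cancelʳ)

  conj-fixed⇒commute : ∀ {g x} → conj g x ≈ x → Commute g x
  conj-fixed⇒commute {g} {x} e = trans (sym (∙⁻¹∙-cancel (g ∙ x) g)) (∙-congʳ e)

  -- Pigeonhole on the n + 1 conjugates of x by z ^ 0, …, z ^ n.
  commuting-power : ∀ {n} x z (f : Fin n → Carrier) → (∀ t → ∃ λ i → f i ≈ conj (pow z t) x) →
                    ∃ λ d → 0 < d × d ≤ n × Commute (pow z d) x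
  commuting-power {n} x z f covers with pigeonhole (n<1+n n) (proj₁ ∘ covers ∘ toℕ)
  ... | i , j , i<j , same-index = d , m<n⇒0<n∸m i<j , d≤n , conj-fixed⇒commute (sym x≈conjᵈx)
    where
    t₁ t₂ d : ℕ
    t₁ = toℕ i
    t₂ = toℕ j
    d = t₂ ∸ t₁
    d≤n : d ≤ n
    d≤n = ≤-trans (m∸n≤m t₂ t₁) (s≤s⁻¹ (toℕ<n j))
    zᵗ²≈zᵗ¹∙zᵈ : pow z t₂ ≈ pow z t₁ ∙ pow z d
    zᵗ²≈zᵗ¹∙zᵈ = trans (pow-congʳ z (≡.sym (m+[n∸m]≡n (<⇒≤ i<j)))) (pow-+ z t₁ d)
    x≈conjᵈx : x ≈ conj (pow z d) x
    x≈conjᵈx = conj-injective (pow z t₁) (begin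
      conj (pow z t₁) x                  ≈⟨ sym (proj₂ (covers t₁)) ⟩
      f (proj₁ (covers t₁))              ≡⟨ ≡.cong f same-index ⟩
      f (proj₁ (covers t₂))              ≈⟨ proj₂ (covers t₂) ⟩
      conj (pow z t₂) x                  ≈⟨ ∙-cong (∙-congʳ zᵗ²≈zᵗ¹∙zᵈ) (⁻¹-cong zᵗ²≈zᵗ¹∙zᵈ) ⟩
      conj (pow z t₁ ∙ pow z d) x        ≈⟨ conj-∙ (pow z t₁) (pow z d) x ⟩
      conj (pow z t₁) (conj (pow z d) x) ∎)

module Orders {c ℓ} (G : Group c ℓ) where
  open Group G
  open GroupProperties G using (inverseʳ-unique)
  open Powers G
  open Conjugation G
  open import Relation.Binary.Reasoning.Setoid setoid

  pow-mod : ∀ {x o} .{{_ : NonZero o}} → pow x o ≈ ε → ∀ n → pow x n ≈ pow x (n % o)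
  pow-mod {x} {o} xᵒ≈ε n = begin
    pow x n                         ≈⟨ pow-congʳ x (m≡m%n+[m/n]*n n o) ⟩
    pow x (n % o + (n / o) * o)     ≈⟨ pow-+ x (n % o) ((n / o) * o) ⟩
    pow x (n % o) ∙ pow x ((n / o) * o) ≈⟨ ∙-congˡ (pow-* x (n / o) o) ⟩
    pow x (n % o) ∙ pow (pow x o) (n / o) ≈⟨ ∙-congˡ (trans (pow-congˡ (n / o) xᵒ≈ε) (pow-ε (n / o))) ⟩
    pow x (n % o) ∙ ε               ≈⟨ identityʳ _ ⟩
    pow x (n % o)                   ∎

  ∣⇒pow≈ε : ∀ {x o n} → pow x o ≈ ε → o ∣ n → pow x n ≈ ε
  ∣⇒pow≈ε {x} {o} xᵒ≈ε (divides q ≡.refl) = trans (pow-* x q o) (trans (pow-congˡ q xᵒ≈ε) (pow-ε q))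

  order∣ : ∀ {x o n} → HasOrder G x o → pow x n ≈ ε → o ∣ n
  order∣ {x} {o} {n} (o>0 , xᵒ≈ε , minimal) xⁿ≈ε =
    m%n≡0⇒n∣m n o (remainder≡0 (n % o) (m%n<n n o) (trans (sym (pow-mod xᵒ≈ε n)) xⁿ≈ε))
    where
    instance
      o≢0 : NonZero o
      o≢0 = >-nonZero o>0
    remainder≡0 : ∀ r → r < o → pow x r ≈ ε → r ≡ 0
    remainder≡0 zero    _   _ = ≡.refl
    remainder≡0 (suc r) r<o e = ⊥-elim (<⇒≱ r<o (minimal (suc r) (s≤s z≤n) e))

  HasOrder-conj : ∀ g {x o} → HasOrder G x o → HasOrder G (conj g x) o
  HasOrder-conj g {x} {o} (o>0 , xᵒ≈ε , minimal) =
    o>0 , trans (conj-pow g x o) (trans (∙-congʳ (∙-congˡ xᵒ≈ε)) (conj-ε g)) ,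
    λ n n>0 e → minimal n n>0 (conj-injective g (trans (sym (conj-pow g x n)) (trans e (sym (conj-ε g)))))

  infix 4 _∈⟨_⟩
  _∈⟨_⟩ : Carrier → Carrier → Set ℓ
  x ∈⟨ y ⟩ = ∃ λ n → x ≈ pow y n

  pow∈⟨⟩ : ∀ x n → pow x n ∈⟨ x ⟩
  pow∈⟨⟩ x n = n , refl

  ε∈⟨⟩ : ∀ y → ε ∈⟨ y ⟩
  ε∈⟨⟩ y = 0 , refl

  ∈⟨⟩-reflexive : ∀ {x y} → x ≈ y → x ∈⟨ y ⟩
  ∈⟨⟩-reflexive x≈y = 1 , trans x≈y (sym (pow-1 _))

  ∈⟨⟩-respˡ : ∀ {x x′ y} → x ≈ x′ → x ∈⟨ y ⟩ → x′ ∈⟨ y ⟩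
  ∈⟨⟩-respˡ x≈x′ (n , x≈yⁿ) = n , trans (sym x≈x′) x≈yⁿ

  ∈⟨⟩-respʳ : ∀ {x y y′} → y ≈ y′ → x ∈⟨ y ⟩ → x ∈⟨ y′ ⟩
  ∈⟨⟩-respʳ y≈y′ (n , x≈yⁿ) = n , trans x≈yⁿ (pow-congˡ n y≈y′)

  ∈⟨⟩-trans : ∀ {x y z} → x ∈⟨ y ⟩ → y ∈⟨ z ⟩ → x ∈⟨ z ⟩
  ∈⟨⟩-trans {z = z} (m , x≈yᵐ) (n , y≈zⁿ) = m * n , trans x≈yᵐ (trans (pow-congˡ m y≈zⁿ) (sym (pow-* z m n)))

  ∈⟨⟩-pow≈ε : ∀ {x y} n → x ∈⟨ y ⟩ → pow y n ≈ ε → pow x n ≈ ε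
  ∈⟨⟩-pow≈ε {x} {y} n (a , x≈yᵃ) yⁿ≈ε =
    trans (pow-congˡ n x≈yᵃ) (trans (pow-swap y a n) (trans (pow-congˡ a yⁿ≈ε) (pow-ε a)))

  ∈⟨⟩-∙ : ∀ {x y z} → x ∈⟨ z ⟩ → y ∈⟨ z ⟩ → x ∙ y ∈⟨ z ⟩
  ∈⟨⟩-∙ {z = z} (a , x≈zᵃ) (b , y≈zᵇ) = a + b , trans (∙-cong x≈zᵃ y≈zᵇ) (sym (pow-+ z a b))

  ⁻¹∈⟨⟩ : ∀ {x z o} → 0 < o → pow z o ≈ ε → x ∈⟨ z ⟩ → x ⁻¹ ∈⟨ z ⟩
  ⁻¹∈⟨⟩ {x} {z} {suc o} _ zᵒ≈ε (a , x≈zᵃ) = o * a , sym (inverseʳ-unique x (pow z (o * a)) x∙zᵒᵃ≈ε)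
    where
    x∙zᵒᵃ≈ε : x ∙ pow z (o * a) ≈ ε
    x∙zᵒᵃ≈ε = begin
      x ∙ pow z (o * a)         ≈⟨ ∙-congʳ x≈zᵃ ⟩
      pow z a ∙ pow z (o * a)   ≈⟨ sym (pow-+ z a (o * a)) ⟩
      pow z (suc o * a)         ≈⟨ pow-*′ z (suc o) a ⟩
      pow (pow z (suc o)) a     ≈⟨ pow-congˡ a zᵒ≈ε ⟩
      pow ε a                   ≈⟨ pow-ε a ⟩
      ε                         ∎

  ∈⟨⟩-cancelʳ : ∀ {x y z o} → 0 < o → pow z o ≈ ε → x ∙ y ∈⟨ z ⟩ → y ∈⟨ z ⟩ → x ∈⟨ z ⟩
  ∈⟨⟩-cancelʳ {x} {y} o>0 zᵒ≈ε xy∈⟨z⟩ y∈⟨z⟩ =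
    ∈⟨⟩-respˡ (∙∙⁻¹-cancel x y) (∈⟨⟩-∙ xy∈⟨z⟩ (⁻¹∈⟨⟩ o>0 zᵒ≈ε y∈⟨z⟩))

  ∈⟨⟩-bounded : ∀ {x y o} .{{_ : NonZero o}} → pow y o ≈ ε → x ∈⟨ y ⟩ → ∃ λ e → e < o × x ≈ pow y e
  ∈⟨⟩-bounded {o = o} yᵒ≈ε (n , x≈yⁿ) = n % o , m%n<n n o , trans x≈yⁿ (pow-mod yᵒ≈ε n)

  -- An exponent a coprime to the order o is invertible modulo o (Bézout).
  ∈⟨pow⟩ : ∀ {z o} a → 0 < o → pow z o ≈ ε → Coprime a o → z ∈⟨ pow z a ⟩
  ∈⟨pow⟩ {z} {o} a o>0 zᵒ≈ε coprime with coprime-Bézout coprime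
  ... | Bézout.+- u v 1+vo≡ua = u , sym (begin
    pow (pow z a) u       ≈⟨ sym (pow-* z u a) ⟩
    pow z (u * a)         ≈⟨ pow-congʳ z (≡.sym 1+vo≡ua) ⟩
    pow z (1 + v * o)     ≈⟨ pow-+ z 1 (v * o) ⟩
    pow z 1 ∙ pow z (v * o) ≈⟨ ∙-cong (pow-1 z) (∣⇒pow≈ε zᵒ≈ε (n∣m*n v)) ⟩
    z ∙ ε                 ≈⟨ identityʳ z ⟩
    z                     ∎)
  -- Here 1 + u a = v (1 + o), so u o is an inverse of a modulo 1 + o.
  ∈⟨pow⟩ {z} {suc o} a o>0 zᵒ≈ε coprime | Bézout.-+ u v 1+ua≡vo = u * o , sym (begin
    pow (pow z a) (u * o)               ≈⟨ sym (pow-* z (u * o) a) ⟩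
    pow z (u * o * a)                   ≈⟨ sym (identityʳ _) ⟩
    pow z (u * o * a) ∙ ε               ≈⟨ ∙-congˡ (sym zᵒ≈ε) ⟩
    pow z (u * o * a) ∙ pow z (suc o)   ≈⟨ sym (pow-+ z (u * o * a) (suc o)) ⟩
    pow z (u * o * a + suc o)           ≈⟨ pow-congʳ z exponent ⟩
    pow z (1 + (v * o) * suc o)         ≈⟨ pow-+ z 1 ((v * o) * suc o) ⟩
    pow z 1 ∙ pow z ((v * o) * suc o)   ≈⟨ ∙-cong (pow-1 z) (∣⇒pow≈ε zᵒ≈ε (n∣m*n (v * o))) ⟩
    z ∙ ε                               ≈⟨ identityʳ z ⟩
    z                                   ∎)
    where
    rearrange : ∀ u o a → u * o * a + suc o ≡ 1 + o * (1 + u * a)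
    rearrange = solve-∀
    regroup : ∀ o v → 1 + o * (v * suc o) ≡ 1 + (v * o) * suc o
    regroup = solve-∀
    exponent : u * o * a + suc o ≡ 1 + (v * o) * suc o
    exponent = ≡.trans (rearrange u o a) (≡.trans (≡.cong (λ t → 1 + o * t) 1+ua≡vo) (regroup o v))

module IntegerPowers {c ℓ} (G : Group c ℓ) where
  open Group G
  open GroupProperties G using (⁻¹-anti-homo-∙; ε⁻¹≈ε; ⁻¹-involutive; ⁻¹-injective)
  open Powers G
  open Orders G
  open import Relation.Binary.Reasoning.Setoid setoid

  zpow : Carrier → ℤ → Carrier
  zpow = Defs.zpow G

  zpow-congˡ : ∀ {x y} a → x ≈ y → zpow x a ≈ zpow y a
  zpow-congˡ (+ n)    x≈y = pow-congˡ n x≈y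
  zpow-congˡ -[1+ n ] x≈y = ⁻¹-cong (pow-congˡ (suc n) x≈y)

  zpow-congʳ : ∀ x {a b} → a ≡ b → zpow x a ≈ zpow x b
  zpow-congʳ x ≡.refl = refl

  zpow-⊖ : ∀ x m n → zpow x (m ⊖ n) ≈ pow x m ∙ pow x n ⁻¹
  zpow-⊖ x m zero = begin
    zpow x (m ⊖ 0)   ≈⟨ zpow-congʳ x (⊖-≥ {m} {0} z≤n) ⟩
    pow x m          ≈⟨ sym (identityʳ _) ⟩
    pow x m ∙ ε      ≈⟨ ∙-congˡ (sym ε⁻¹≈ε) ⟩
    pow x m ∙ ε ⁻¹   ∎
  zpow-⊖ x zero (suc n) = trans (zpow-congʳ x (⊖-< {0} {suc n} z<s)) (sym (identityˡ _))
  zpow-⊖ x (suc m) (suc n) = begin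
    zpow x (suc m ⊖ suc n)                  ≈⟨ zpow-congʳ x ([1+m]⊖[1+n]≡m⊖n m n) ⟩
    zpow x (m ⊖ n)                          ≈⟨ zpow-⊖ x m n ⟩
    pow x m ∙ pow x n ⁻¹                    ≈⟨ ∙-congʳ (sym (∙∙⁻¹-cancel (pow x m) x)) ⟩
    pow x m ∙ x ∙ x ⁻¹ ∙ pow x n ⁻¹         ≈⟨ assoc _ _ _ ⟩
    (pow x m ∙ x) ∙ (x ⁻¹ ∙ pow x n ⁻¹)     ≈⟨ ∙-congˡ (sym (⁻¹-anti-homo-∙ (pow x n) x)) ⟩
    (pow x m ∙ x) ∙ (pow x n ∙ x) ⁻¹        ≈⟨ ∙-cong (sym (pow-suc′ x m)) (⁻¹-cong (sym (pow-suc′ x n))) ⟩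
    pow x (suc m) ∙ pow x (suc n) ⁻¹        ∎

  zpow-+ : ∀ x a b → zpow x (a ℤ.+ b) ≈ zpow x a ∙ zpow x b
  zpow-+ x (+ m)    (+ n)    = pow-+ x m n
  zpow-+ x (+ m)    -[1+ n ] = zpow-⊖ x m (suc n)
  zpow-+ x -[1+ m ] (+ n)    = trans (zpow-⊖ x n (suc m)) (commute-⁻¹ (pow-comm x n (suc m)))
  zpow-+ x -[1+ m ] -[1+ n ] = begin
    pow x (suc (suc (m + n))) ⁻¹      ≈⟨ ⁻¹-cong (pow-congʳ x exponent) ⟩
    pow x (suc n + suc m) ⁻¹          ≈⟨ ⁻¹-cong (pow-+ x (suc n) (suc m)) ⟩
    (pow x (suc n) ∙ pow x (suc m)) ⁻¹ ≈⟨ ⁻¹-anti-homo-∙ _ _ ⟩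
    pow x (suc m) ⁻¹ ∙ pow x (suc n) ⁻¹ ∎
    where
    exponent : suc (suc (m + n)) ≡ suc n + suc m
    exponent = ≡.cong suc (≡.trans (≡.cong suc (+-comm m n)) (≡.sym (+-suc n m)))

  zpow-neg : ∀ x a → zpow x (ℤ.- a) ≈ zpow x a ⁻¹
  zpow-neg x (+ zero)  = sym ε⁻¹≈ε
  zpow-neg x (+ suc n) = refl
  zpow-neg x -[1+ n ]  = sym (⁻¹-involutive _)

  zpow-* : ∀ x a n → zpow x (a ℤ.* + n) ≈ zpow (pow x n) a
  zpow-* x (+ m)    n = trans (zpow-congʳ x (≡.sym (pos-* m n))) (pow-* x m n)
  zpow-* x -[1+ m ] n = begin
    zpow x (-[1+ m ] ℤ.* + n)       ≈⟨ zpow-congʳ x (≡.sym (neg-distribˡ-* (+ suc m) (+ n))) ⟩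
    zpow x (ℤ.- (+ suc m ℤ.* + n))  ≈⟨ zpow-congʳ x (≡.cong ℤ.-_ (≡.sym (pos-* (suc m) n))) ⟩
    zpow x (ℤ.- + (suc m * n))      ≈⟨ zpow-neg x (+ (suc m * n)) ⟩
    pow x (suc m * n) ⁻¹            ≈⟨ ⁻¹-cong (pow-* x (suc m) n) ⟩
    pow (pow x n) (suc m) ⁻¹        ∎

  zpow≈ε⇒∣ : ∀ {x o} → HasOrder G x o → ∀ a → zpow x a ≈ ε → o ∣ ℤ.∣ a ∣
  zpow≈ε⇒∣ xᵒ (+ n)    e = order∣ xᵒ e
  zpow≈ε⇒∣ xᵒ -[1+ n ] e = order∣ xᵒ (⁻¹-injective (trans e (sym ε⁻¹≈ε)))

  ∣⇒zpow≈ε : ∀ {x o} → pow x o ≈ ε → ∀ a → o ∣ ℤ.∣ a ∣ → zpow x a ≈ ε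
  ∣⇒zpow≈ε xᵒ≈ε (+ n)    o∣n = ∣⇒pow≈ε xᵒ≈ε o∣n
  ∣⇒zpow≈ε xᵒ≈ε -[1+ n ] o∣n = trans (⁻¹-cong (∣⇒pow≈ε xᵒ≈ε o∣n)) ε⁻¹≈ε

  zpow-≈⇒∣ : ∀ {x o} → HasOrder G x o → ∀ a b → zpow x a ≈ zpow x b → o ∣ ℤ.∣ a ℤ.- b ∣
  zpow-≈⇒∣ {x} xᵒ a b xᵃ≈xᵇ = zpow≈ε⇒∣ xᵒ (a ℤ.- b) (begin
    zpow x (a ℤ.- b)              ≈⟨ zpow-+ x a (ℤ.- b) ⟩
    zpow x a ∙ zpow x (ℤ.- b)     ≈⟨ ∙-cong xᵃ≈xᵇ (zpow-neg x b) ⟩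
    zpow x b ∙ zpow x b ⁻¹        ≈⟨ inverseʳ _ ⟩
    ε                             ∎)

  ∣⇒zpow-≈ : ∀ {x o} → pow x o ≈ ε → ∀ a b → o ∣ ℤ.∣ a ℤ.- b ∣ → zpow x a ≈ zpow x b
  ∣⇒zpow-≈ {x} xᵒ≈ε a b o∣a-b = begin
    zpow x a                         ≈⟨ zpow-congʳ x (≡.sym a-b+b≡a) ⟩
    zpow x ((a ℤ.- b) ℤ.+ b)         ≈⟨ zpow-+ x (a ℤ.- b) b ⟩
    zpow x (a ℤ.- b) ∙ zpow x b      ≈⟨ ∙-congʳ (∣⇒zpow≈ε xᵒ≈ε (a ℤ.- b) o∣a-b) ⟩
    ε ∙ zpow x b                     ≈⟨ identityˡ _ ⟩
    zpow x b                         ∎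
    where
    a-b+b≡a : (a ℤ.- b) ℤ.+ b ≡ a
    a-b+b≡a = ≡.trans (ℤP.+-assoc a (ℤ.- b) b)
                (≡.trans (≡.cong (λ t → a ℤ.+ t) (ℤP.+-inverseˡ b)) (ℤP.+-identityʳ a))

  zpow∈⟨⟩ : ∀ {x o} → 0 < o → pow x o ≈ ε → ∀ a → zpow x a ∈⟨ x ⟩
  zpow∈⟨⟩ {x} o>0 xᵒ≈ε (+ n)    = pow∈⟨⟩ x n
  zpow∈⟨⟩ {x} o>0 xᵒ≈ε -[1+ n ] = ⁻¹∈⟨⟩ o>0 xᵒ≈ε (pow∈⟨⟩ x (suc n))

module PrimePowers {p} (p-prime : Prime p) where

  instance
    p≢0 : NonZero p
    p≢0 = prime⇒nonZero p-prime

  1<p : 1 < p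
  1<p = ℕ.nonTrivial⇒n>1 p {{prime⇒nonTrivial p-prime}}

  p^-∣-p^ : ∀ {j k} → j ≤ k → p ^ j ∣ p ^ k
  p^-∣-p^ {j} {k} j≤k = divides (p ^ (k ∸ j)) (begin-equality
    p ^ k                 ≡⟨ ≡.cong (p ^_) (≡.sym (m+[n∸m]≡n j≤k)) ⟩
    p ^ (j + (k ∸ j))     ≡⟨ ^-distribˡ-+-* p j (k ∸ j) ⟩
    p ^ j * p ^ (k ∸ j)   ≡⟨ *-comm (p ^ j) _ ⟩
    p ^ (k ∸ j) * p ^ j   ∎)
    where open ≤-Reasoning

  p^∣p^⇒≤ : ∀ {j k} → p ^ j ∣ p ^ k → j ≤ k
  p^∣p^⇒≤ {j} {k} p^j∣p^k with j ≤? k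
  ... | yes j≤k = j≤k
  ... | no  j≰k = ⊥-elim (<⇒≱ (^-monoʳ-< p 1<p (≰⇒> j≰k)) (∣⇒≤ {{m^n≢0 p k}} p^j∣p^k))

  n<p^n : ∀ n → n < p ^ n
  n<p^n zero    = z<s
  n<p^n (suc n) = begin-strict
    suc n          ≤⟨ n<p^n n ⟩
    p ^ n          <⟨ m<m+n (p ^ n) (m^n>0 p n) ⟩
    p ^ n + p ^ n  ≡⟨ ≡.cong (λ t → p ^ n + t) (≡.sym (+-identityʳ (p ^ n))) ⟩
    2 * p ^ n      ≤⟨ *-monoˡ-≤ (p ^ n) 1<p ⟩
    p * p ^ n      ∎
    where open ≤-Reasoning

  p^-bound : ∀ {N k T m d} → d ≤ N * p ^ k → T + (N + k) ≤ m → p ^ T * d < p ^ m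
  p^-bound {N} {k} {T} {m} {d} d≤Np^k T+N+k≤m = begin-strict
    p ^ T * d               ≤⟨ *-monoʳ-≤ (p ^ T) d≤Np^k ⟩
    p ^ T * (N * p ^ k)     <⟨ *-monoʳ-< (p ^ T) {{m^n≢0 p T}} (*-monoˡ-< (p ^ k) {{m^n≢0 p k}} (n<p^n N)) ⟩
    p ^ T * (p ^ N * p ^ k) ≡⟨ ≡.cong (p ^ T *_) (≡.sym (^-distribˡ-+-* p N k)) ⟩
    p ^ T * p ^ (N + k)     ≡⟨ ≡.sym (^-distribˡ-+-* p T (N + k)) ⟩
    p ^ (T + (N + k))       ≤⟨ ^-monoʳ-≤ p T+N+k≤m ⟩
    p ^ m                   ∎
    where open ≤-Reasoning

  coprime-p^ : ∀ {a} → ¬ p ∣ a → ∀ m → Coprime a (p ^ m)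
  coprime-p^ p∤a zero    (_ , d∣1) = ∣1⇒≡1 d∣1
  coprime-p^ {a} p∤a (suc m) {d} (d∣a , d∣p^[1+m]) = coprime-p^ p∤a m (d∣a , coprime-divisor d⊥p d∣p^[1+m])
    where
    d⊥p : Coprime d p
    d⊥p {e} (e∣d , e∣p) with prime⇒irreducible p-prime e∣p
    ... | inj₁ e≡1   = e≡1
    ... | inj₂ ≡.refl = ⊥-elim (p∤a (∣-trans e∣d d∣a))

module PrimePowerOrders {c ℓ} (G : Group c ℓ) {p} (p-prime : Prime p) where
  open Group G
  open Powers G
  open Orders G
  open PrimePowers p-prime
  open import Relation.Binary.Reasoning.Setoid setoid

  HasExponent : Set (c ⊔ ℓ)
  HasExponent = ∃ λ K → ∀ x → pow x (p ^ K) ≈ ε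

  IsPGroup⇒torsion : IsPGroup G p → ∀ x → ∃ (HasOrder G x)
  IsPGroup⇒torsion isP x = p ^ proj₁ (isP x) , proj₂ (isP x)

  order≤ : ∀ {x j K} → HasOrder G x (p ^ j) → pow x (p ^ K) ≈ ε → j ≤ K
  order≤ xᵒ e = p^∣p^⇒≤ (order∣ xᵒ e)

  order> : ∀ {x j K} → HasOrder G x (p ^ j) → ¬ pow x (p ^ K) ≈ ε → K < j
  order> {x} {j} {K} (_ , xᵒ≈ε , _) ne with K <? j
  ... | yes K<j = K<j
  ... | no  K≮j = ⊥-elim (ne (∣⇒pow≈ε xᵒ≈ε (p^-∣-p^ (≮⇒≥ K≮j))))

  HasOrder-exact : ∀ {x j k} → HasOrder G x (p ^ j) → pow x (p ^ suc k) ≈ ε → ¬ pow x (p ^ k) ≈ ε →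
                   HasOrder G x (p ^ suc k)
  HasOrder-exact {x} {j} {k} xᵒ e ne =
    ≡.subst (λ t → HasOrder G x (p ^ t)) (≤-antisym (order≤ {x} {j} {suc k} xᵒ e) (order> {x} {j} {k} xᵒ ne)) xᵒ

  HasOrder-pow : ∀ {x} i k → HasOrder G x (p ^ (i + k)) → HasOrder G (pow x (p ^ i)) (p ^ k)
  HasOrder-pow {x} i k xᵒ@(_ , xᵒ≈ε , _) = m^n>0 p k , power≈ε , minimal
    where
    p^k*p^i≡p^[i+k] : p ^ k * p ^ i ≡ p ^ (i + k)
    p^k*p^i≡p^[i+k] = ≡.trans (*-comm (p ^ k) (p ^ i)) (≡.sym (^-distribˡ-+-* p i k))
    power≈ε : pow (pow x (p ^ i)) (p ^ k) ≈ ε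
    power≈ε = trans (sym (pow-* x (p ^ k) (p ^ i))) (trans (pow-congʳ x p^k*p^i≡p^[i+k]) xᵒ≈ε)
    minimal : ∀ n → 0 < n → pow (pow x (p ^ i)) n ≈ ε → p ^ k ≤ n
    minimal n n>0 e = ∣⇒≤ {{>-nonZero n>0}} (*-cancelʳ-∣ (p ^ i) {{m^n≢0 p i}}
      (≡.subst (_∣ n * p ^ i) (≡.sym p^k*p^i≡p^[i+k]) (order∣ xᵒ (trans (pow-* x n (p ^ i)) e))))

  p∣-of-pow≈ε : ∀ {y t a} → HasOrder G y (p ^ suc t) → pow y (p ^ t * a) ≈ ε → p ∣ a
  p∣-of-pow≈ε {y} {t} {a} yᵒ e =
    *-cancelʳ-∣ (p ^ t) {{m^n≢0 p t}} (≡.subst (p ^ suc t ∣_) (*-comm (p ^ t) a) (order∣ yᵒ e))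

  HasOrder-p^0⇒≈ε : ∀ {x} → HasOrder G x (p ^ 0) → x ≈ ε
  HasOrder-p^0⇒≈ε {x} (_ , x¹≈ε , _) = trans (sym (pow-1 x)) x¹≈ε

  pow-of-large-order : ∀ {z m d T} → HasOrder G z (p ^ m) → 0 < d → p ^ T * d < p ^ m →
                       ¬ pow (pow z d) (p ^ T) ≈ ε
  pow-of-large-order {z} {m} {d} {T} zᵒ d>0 small e =
    <⇒≱ small (∣⇒≤ {{m*n≢0 (p ^ T) d {{m^n≢0 p T}} {{>-nonZero d>0}}}}
                 (order∣ zᵒ (trans (pow-* z (p ^ T) d) e)))

  ∈⟨pow⟩-p∤ : ∀ {z m a} → HasOrder G z (p ^ m) → ¬ p ∣ a → z ∈⟨ pow z a ⟩
  ∈⟨pow⟩-p∤ {m = m} {a} (o>0 , zᵒ≈ε , _) p∤a = ∈⟨pow⟩ a o>0 zᵒ≈ε (coprime-p^ p∤a m)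

  -- If y = x ^ (q p) had the same order p ^ (1 + k) as x, then y ^ (p ^ k) = ε.
  ∈⟨⟩-sym : ∀ {x y} k → HasOrder G x (p ^ k) → HasOrder G y (p ^ k) → y ∈⟨ x ⟩ → x ∈⟨ y ⟩
  ∈⟨⟩-sym {x} {y} k xᵒ yᵒ (a , y≈xᵃ) with p ∣? a
  ... | no  p∤a = ∈⟨⟩-respʳ (sym y≈xᵃ) (∈⟨pow⟩-p∤ {x} {k} xᵒ p∤a)
  ∈⟨⟩-sym {x} {y} zero    xᵒ yᵒ (a , y≈xᵃ) | yes _ = ∈⟨⟩-respˡ (sym (HasOrder-p^0⇒≈ε xᵒ)) (ε∈⟨⟩ y)
  ∈⟨⟩-sym {x} {y} (suc k) xᵒ@(_ , xᵒ≈ε , _) (_ , _ , minimal) (a , y≈xᵃ) | yes (divides q ≡.refl) =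
    ⊥-elim (<⇒≱ (^-monoʳ-< p 1<p (n<1+n k)) (minimal (p ^ k) (m^n>0 p k) yᵖᵏ≈ε))
    where
    exponent : p ^ k * (q * p) ≡ q * p ^ suc k
    exponent = rearrange (p ^ k) q p
      where
      rearrange : ∀ P q p → P * (q * p) ≡ q * (p * P)
      rearrange = solve-∀
    yᵖᵏ≈ε : pow y (p ^ k) ≈ ε
    yᵖᵏ≈ε = begin
      pow y (p ^ k)                 ≈⟨ pow-congˡ (p ^ k) y≈xᵃ ⟩
      pow (pow x (q * p)) (p ^ k)   ≈⟨ sym (pow-* x (p ^ k) (q * p)) ⟩
      pow x (p ^ k * (q * p))       ≈⟨ ∣⇒pow≈ε xᵒ≈ε (divides q exponent) ⟩
      ε                             ∎

  -- Both exponents divisible by p means both elements lie in ⟨z ^ p⟩, of smaller order.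
  ∈⟨⟩-total : ∀ m {z x y} → HasOrder G z (p ^ m) → x ∈⟨ z ⟩ → y ∈⟨ z ⟩ → x ∈⟨ y ⟩ ⊎ y ∈⟨ x ⟩
  ∈⟨⟩-total m {z} zᵒ (a , x≈zᵃ) (b , y≈zᵇ) with p ∣? a | p ∣? b
  ... | no p∤a | _      = inj₂ (∈⟨⟩-trans (b , y≈zᵇ) (∈⟨⟩-respʳ (sym x≈zᵃ) (∈⟨pow⟩-p∤ {z} {m} zᵒ p∤a)))
  ... | yes _  | no p∤b = inj₁ (∈⟨⟩-trans (a , x≈zᵃ) (∈⟨⟩-respʳ (sym y≈zᵇ) (∈⟨pow⟩-p∤ {z} {m} zᵒ p∤b)))
  ∈⟨⟩-total zero {z} {x} {y} zᵒ (a , x≈zᵃ) _ | yes _ | yes _ =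
    inj₁ (∈⟨⟩-respˡ (sym (trans x≈zᵃ (trans (pow-congˡ a (HasOrder-p^0⇒≈ε zᵒ)) (pow-ε a)))) (ε∈⟨⟩ y))
  ∈⟨⟩-total (suc m) {z} zᵒ (_ , x≈zᵃ) (_ , y≈zᵇ) | yes (divides q ≡.refl) | yes (divides r ≡.refl) =
    ∈⟨⟩-total m (HasOrder-pow 1 m zᵒ) (q , in⟨zᵖ⟩ q x≈zᵃ) (r , in⟨zᵖ⟩ r y≈zᵇ)
    where
    in⟨zᵖ⟩ : ∀ {w} s → w ≈ pow z (s * p) → w ≈ pow (pow z (p ^ 1)) s
    in⟨zᵖ⟩ s w≈zˢᵖ = trans w≈zˢᵖ (trans (pow-* z s p) (pow-congˡ s (pow-congʳ z (≡.sym (*-identityʳ p)))))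

module Covering {c ℓ} (S : Setoid c ℓ) where
  open Setoid S

  CoveredBy : ∀ {q} → ℕ → (Carrier → Set q) → Set (c ⊔ ℓ ⊔ q)
  CoveredBy n P = Σ (Fin n → Carrier) λ f → ∀ x → P x → ∃ λ i → f i ≈ x

  CoveredBy-⊆ : ∀ {q r n} {P : Carrier → Set q} {Q : Carrier → Set r} →
                (∀ x → Q x → P x) → CoveredBy n P → CoveredBy n Q
  CoveredBy-⊆ Q⊆P (f , f-covers) = f , λ x Qx → f-covers x (Q⊆P x Qx)

  CoveredBy-∪ : ∀ {q r m n} {P : Carrier → Set q} {Q : Carrier → Set r} →
                CoveredBy m P → CoveredBy n Q → CoveredBy (m + n) (λ x → P x ⊎ Q x)
  CoveredBy-∪ {m = m} {n} (f , f-covers) (g , g-covers) = [ f , g ]′ ∘ splitAt m , covers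
    where
    covers : ∀ x → _ ⊎ _ → ∃ λ i → [ f , g ]′ (splitAt m i) ≈ x
    covers x (inj₁ Px) with f-covers x Px
    ... | i , fi≈x = i ↑ˡ n , trans (reflexive (≡.cong [ f , g ]′ (splitAt-↑ˡ m i n))) fi≈x
    covers x (inj₂ Qx) with g-covers x Qx
    ... | i , gi≈x = m ↑ʳ i , trans (reflexive (≡.cong [ f , g ]′ (splitAt-↑ʳ m n i))) gi≈x

module PowerGraph {c ℓ} (G : Group c ℓ) (lem : ∀ {a} → ExcludedMiddle a)
                  (order : ∀ x → ∃ (HasOrder G x)) where
  open Group G
  open Orders G
  open IntegerPowers G

  NonAdjacent : Carrier → Carrier → Set ℓ
  NonAdjacent x y = ¬ x ≈ y × ¬ PowerAdj G x y

  torsion-zpow∈⟨⟩ : ∀ x a → zpow x a ∈⟨ x ⟩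
  torsion-zpow∈⟨⟩ x a with order x
  ... | o , o>0 , xᵒ≈ε , _ = zpow∈⟨⟩ o>0 xᵒ≈ε a

  ¬NonAdjacent⇒comparable : ∀ {x y} → ¬ NonAdjacent x y → x ∈⟨ y ⟩ ⊎ y ∈⟨ x ⟩
  ¬NonAdjacent⇒comparable {x} {y} ¬xy with lem {P = x ≈ y} | lem {P = PowerAdj G x y}
  ... | yes x≈y | _                          = inj₁ (∈⟨⟩-reflexive x≈y)
  ... | no _    | yes (_ , inj₁ (a , y≈xᵃ)) = inj₂ (∈⟨⟩-respˡ (sym y≈xᵃ) (torsion-zpow∈⟨⟩ x a))
  ... | no _    | yes (_ , inj₂ (a , x≈yᵃ)) = inj₁ (∈⟨⟩-respˡ (sym x≈yᵃ) (torsion-zpow∈⟨⟩ y a))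
  ... | no x≉y  | no ¬adjacent              = ⊥-elim (¬xy (x≉y , ¬adjacent))

  incomparable⇒NonAdjacent : ∀ {x y} → ¬ x ∈⟨ y ⟩ → ¬ y ∈⟨ x ⟩ → NonAdjacent x y
  incomparable⇒NonAdjacent {x} {y} x∉⟨y⟩ y∉⟨x⟩ = x∉⟨y⟩ ∘ ∈⟨⟩-reflexive , λ where
    (_ , inj₁ (a , y≈xᵃ)) → y∉⟨x⟩ (∈⟨⟩-respˡ (sym y≈xᵃ) (torsion-zpow∈⟨⟩ x a))
    (_ , inj₂ (a , x≈yᵃ)) → x∉⟨y⟩ (∈⟨⟩-respˡ (sym x≈yᵃ) (torsion-zpow∈⟨⟩ y a))

module BoundedIndependence {c ℓ} (lem : ∀ {a} → ExcludedMiddle a) (G : Group c ℓ) {p} (p-prime : Prime p)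
                           (isP : IsPGroup G p) (N : ℕ)
                           (bound : ∀ xs → IsIndependent G xs → length xs ≤ N) where
  open Group G
  open Powers G
  open Orders G
  open PrimePowers p-prime
  open PrimePowerOrders G p-prime
  open Covering setoid
  open PowerGraph G lem (IsPGroup⇒torsion isP)

  orderClass-covered : ∀ k → ∃ λ n → n ≤ N * p ^ k × CoveredBy n (λ x → HasOrder G x (p ^ k))
  orderClass-covered k with maximal-AllPairs NonAdjacent lem N bound (λ x → HasOrder G x (p ^ k))
  ... | L , L-order , L-independent , maximal =
    length L * p ^ k , *-monoˡ-≤ (p ^ k) (bound L L-independent) , f , covers
    where
    entry : Fin (length L) → Fin (p ^ k) → Carrier
    entry i e = pow (lookup L i) (toℕ e)

    f : Fin (length L * p ^ k) → Carrier
    f = uncurry entry ∘ remQuot (p ^ k)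

    covers : ∀ x → HasOrder G x (p ^ k) → ∃ λ idx → f idx ≈ x
    covers x xᵒ with maximal x xᵒ
    ... | l∈L with lookupAny L-order l∈L
    ... | lᵒ , ¬xl with ∈⟨⟩-bounded {{m^n≢0 p k}} (proj₁ (proj₂ lᵒ)) x∈⟨l⟩
      where
      x∈⟨l⟩ : x ∈⟨ Any.lookup l∈L ⟩
      x∈⟨l⟩ = [ id , ∈⟨⟩-sym k xᵒ lᵒ ]′ (¬NonAdjacent⇒comparable ¬xl)
    ... | e , e<p^k , x≈lᵉ = combine i (fromℕ< e<p^k) , (begin
      f (combine i (fromℕ< e<p^k))          ≡⟨ ≡.cong (uncurry entry) (remQuot-combine i (fromℕ< e<p^k)) ⟩
      pow (lookup L i) (toℕ (fromℕ< e<p^k)) ≈⟨ pow-congʳ _ (toℕ-fromℕ< e<p^k) ⟩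
      pow (lookup L i) e                    ≈⟨ sym x≈lᵉ ⟩
      x                                     ∎)
      where
      i : Fin (length L)
      i = Any.index l∈L
      open import Relation.Binary.Reasoning.Setoid setoid

  ordersUpTo-covered : ∀ K → ∃ λ n → CoveredBy n (λ x → ∃ λ j → j ≤ K × HasOrder G x (p ^ j))
  ordersUpTo-covered zero with orderClass-covered 0
  ... | n , _ , cover = n , CoveredBy-⊆ (λ { x (_ , z≤n , xᵒ) → xᵒ }) cover
  ordersUpTo-covered (suc K) with ordersUpTo-covered K | orderClass-covered (suc K)
  ... | m , cover | n , _ , cover′ = m + n , CoveredBy-⊆ lowerOrTop (CoveredBy-∪ cover cover′)
    where
    lowerOrTop : ∀ x → (∃ λ j → j ≤ suc K × HasOrder G x (p ^ j)) →
                 (∃ λ j → j ≤ K × HasOrder G x (p ^ j)) ⊎ HasOrder G x (p ^ suc K)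
    lowerOrTop x (j , j≤1+K , xᵒ) with m≤n⇒m<n∨m≡n j≤1+K
    ... | inj₁ j<1+K  = inj₁ (j , s≤s⁻¹ j<1+K , xᵒ)
    ... | inj₂ ≡.refl = inj₂ xᵒ

  no-long-antichain : (v : ℕ → Carrier) → (∀ {i j} → i < j → j ≤ N → ¬ v i ∈⟨ v j ⟩ × ¬ v j ∈⟨ v i ⟩) → ⊥
  no-long-antichain v incomparable =
    1+n≰n (≡.subst (_≤ N) (length-applyUpTo v (suc N)) (bound (applyUpTo v (suc N)) independent))
    where
    independent : IsIndependent G (applyUpTo v (suc N))
    independent = applyUpTo⁺₁ v (suc N) λ i<j j<1+N →
      let (vᵢ∉⟨vⱼ⟩ , vⱼ∉⟨vᵢ⟩) = incomparable i<j (s≤s⁻¹ j<1+N) in incomparable⇒NonAdjacent vᵢ∉⟨vⱼ⟩ vⱼ∉⟨vᵢ⟩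

  HasExponent⇒finite : HasExponent → IsFinite G
  HasExponent⇒finite (K , xᵖᴷ≈ε) with ordersUpTo-covered K
  ... | n , f , covers =
    n , f , λ x → covers x (k x , order≤ {x} {k x} (proj₂ (isP x)) (xᵖᴷ≈ε x) , proj₂ (isP x))
    where
    k : Carrier → ℕ
    k x = proj₁ (isP x)

module CommutingAntichain {c ℓ} (G : Group c ℓ) {p} (p-prime : Prime p) {x w k n}
                          (xᵒ : HasOrder G x (p ^ k)) (wᵒ : HasOrder G w (p ^ n))
                          (w∙x≈x∙w : Powers.Commute G w x) (x∉⟨w⟩ : ¬ Orders._∈⟨_⟩ G x w) where
  open Group G
  open Powers G
  open Orders G
  open IntegerPowers G
  open PrimePowers p-prime
  open PrimePowerOrders G p-prime
  open import Relation.Binary.Reasoning.Setoid setoid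

  wₛ : ℕ → Carrier
  wₛ s = pow w (p ^ (n ∸ s))

  wₛᵒ : ∀ {s} → s ≤ n → HasOrder G (wₛ s) (p ^ s)
  wₛᵒ {s} s≤n = HasOrder-pow (n ∸ s) s (≡.subst (λ e → HasOrder G w (p ^ e)) (≡.sym (m∸n+n≡m s≤n)) wᵒ)

  wₛ∈⟨w⟩ : ∀ s → wₛ s ∈⟨ w ⟩
  wₛ∈⟨w⟩ s = pow∈⟨⟩ w (p ^ (n ∸ s))

  v : ℕ → Carrier
  v s = x ∙ wₛ s

  pow-v-split : ∀ s q → pow (v s) q ≈ pow x q ∙ pow (wₛ s) q
  pow-v-split s = pow-∙-commute (commute-pow (sym w∙x≈x∙w) (p ^ (n ∸ s)))

  pow-v : ∀ s {q} → p ^ k ∣ q → pow (v s) q ≈ pow (wₛ s) q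
  pow-v s {q} p^k∣q = begin
    pow (v s) q               ≈⟨ pow-v-split s q ⟩
    pow x q ∙ pow (wₛ s) q    ≈⟨ ∙-congʳ (∣⇒pow≈ε (proj₁ (proj₂ xᵒ)) p^k∣q) ⟩
    ε ∙ pow (wₛ s) q          ≈⟨ identityˡ _ ⟩
    pow (wₛ s) q              ∎

  pow-v-p^s≈ε : ∀ {s} → k ≤ s → s ≤ n → pow (v s) (p ^ s) ≈ ε
  pow-v-p^s≈ε {s} k≤s s≤n = trans (pow-v s (p^-∣-p^ k≤s)) (proj₁ (proj₂ (wₛᵒ s≤n)))

  higher∉⟨lower⟩ : ∀ {s t} → k ≤ s → s < t → t ≤ n → ¬ v t ∈⟨ v s ⟩
  higher∉⟨lower⟩ {s} {t} k≤s s<t t≤n (u , vₜ≈vₛᵘ) = <⇒≱ s<t (order≤ {wₛ t} {t} {s} (wₛᵒ t≤n) (begin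
    pow (wₛ t) (p ^ s)           ≈⟨ sym (pow-v t (p^-∣-p^ k≤s)) ⟩
    pow (v t) (p ^ s)            ≈⟨ pow-congˡ (p ^ s) vₜ≈vₛᵘ ⟩
    pow (pow (v s) u) (p ^ s)    ≈⟨ pow-swap (v s) u (p ^ s) ⟩
    pow (pow (v s) (p ^ s)) u    ≈⟨ pow-congˡ u (pow-v-p^s≈ε k≤s (≤-trans (<⇒≤ s<t) t≤n)) ⟩
    pow ε u                      ≈⟨ pow-ε u ⟩
    ε                            ∎))

  lower∈⟨higher⟩⇒p∣ : ∀ {s t u} → k ≤ s → s ≤ t → suc t ≤ n → v s ≈ pow (v (suc t)) u → p ∣ u
  lower∈⟨higher⟩⇒p∣ {s} {t} {u} k≤s s≤t t<n vₛ≈vₜᵘ =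
    p∣-of-pow≈ε {wₛ (suc t)} {t} {u} (wₛᵒ t<n) (begin
      pow (wₛ (suc t)) (p ^ t * u)        ≈⟨ sym (pow-v (suc t) (∣m⇒∣m*n u (p^-∣-p^ (≤-trans k≤s s≤t)))) ⟩
      pow (v (suc t)) (p ^ t * u)         ≈⟨ pow-* (v (suc t)) (p ^ t) u ⟩
      pow (pow (v (suc t)) u) (p ^ t)     ≈⟨ pow-congˡ (p ^ t) (sym vₛ≈vₜᵘ) ⟩
      pow (v s) (p ^ t)                   ≈⟨ ∣⇒pow≈ε (pow-v-p^s≈ε k≤s (≤-trans s≤t (<⇒≤ t<n))) (p^-∣-p^ s≤t) ⟩
      ε                                   ∎)

  -- With r = (p ^ k − 1) u we get x ^ (r + 1) ∙ wₛ s = wₛ t ^ u, and p ∤ r + 1 when p ∣ u.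
  lower∈⟨higher⟩⇒p∤ : ∀ {s t u} → s ≤ n → t ≤ n → v s ≈ pow (v t) u → ¬ p ∣ u
  lower∈⟨higher⟩⇒p∤ {s} {t} {u} s≤n t≤n vₛ≈vₜᵘ p∣u@(divides q ≡.refl) =
    x∉⟨w⟩ (∈⟨⟩-trans (∈⟨pow⟩-p∤ {x} {k} xᵒ p∤r+1) xʳ⁺¹∈⟨w⟩)
    where
    r : ℕ
    r = (p ^ k ∸ 1) * u
    p^k∣r+u : p ^ k ∣ r + u
    p^k∣r+u = divides u (≡.trans (+-comm r u)
                (≡.trans (≡.cong (_* u) (m+[n∸m]≡n (m^n>0 p k))) (*-comm (p ^ k) u)))
    p∤r+1 : ¬ p ∣ r + 1
    p∤r+1 p∣r+1 = <⇒≢ 1<p (≡.sym (∣1⇒≡1 (∣m+n∣m⇒∣n p∣r+1 (∣n⇒∣m*n (p ^ k ∸ 1) p∣u))))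
    xʳ⁺¹∙wₛ≈wₜᵘ : pow x (r + 1) ∙ wₛ s ≈ pow (wₛ t) u
    xʳ⁺¹∙wₛ≈wₜᵘ = begin
      pow x (r + 1) ∙ wₛ s                   ≈⟨ ∙-congʳ (trans (pow-+ x r 1) (∙-congˡ (pow-1 x))) ⟩
      pow x r ∙ x ∙ wₛ s                     ≈⟨ assoc _ _ _ ⟩
      pow x r ∙ v s                          ≈⟨ ∙-congˡ vₛ≈vₜᵘ ⟩
      pow x r ∙ pow (v t) u                  ≈⟨ ∙-congˡ (pow-v-split t u) ⟩
      pow x r ∙ (pow x u ∙ pow (wₛ t) u)     ≈⟨ sym (assoc _ _ _) ⟩
      pow x r ∙ pow x u ∙ pow (wₛ t) u       ≈⟨ ∙-congʳ (sym (pow-+ x r u)) ⟩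
      pow x (r + u) ∙ pow (wₛ t) u           ≈⟨ ∙-congʳ (∣⇒pow≈ε (proj₁ (proj₂ xᵒ)) p^k∣r+u) ⟩
      ε ∙ pow (wₛ t) u                       ≈⟨ identityˡ _ ⟩
      pow (wₛ t) u                           ∎
    xʳ⁺¹∈⟨w⟩ : pow x (r + 1) ∈⟨ w ⟩
    xʳ⁺¹∈⟨w⟩ = ∈⟨⟩-cancelʳ (proj₁ wᵒ) (proj₁ (proj₂ wᵒ))
      (∈⟨⟩-respˡ (sym xʳ⁺¹∙wₛ≈wₜᵘ) (∈⟨⟩-trans (pow∈⟨⟩ (wₛ t) u) (wₛ∈⟨w⟩ t))) (wₛ∈⟨w⟩ s)

  lower∉⟨higher⟩ : ∀ {s t} → k ≤ s → s < t → t ≤ n → ¬ v s ∈⟨ v t ⟩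
  lower∉⟨higher⟩ {s} {suc t} k≤s (s≤s s≤t) t<n (u , vₛ≈vₜᵘ) =
    lower∈⟨higher⟩⇒p∤ {s} {suc t} {u} (≤-trans (≤-trans s≤t (n≤1+n t)) t<n) t<n vₛ≈vₜᵘ
      (lower∈⟨higher⟩⇒p∣ {s} {t} {u} k≤s s≤t t<n vₛ≈vₜᵘ)

module Unbounded {c ℓ} (lem : ∀ {a} → ExcludedMiddle a) (G : Group c ℓ) {p} (p-prime : Prime p)
                 (isP : IsPGroup G p) (unbounded : ¬ PrimePowerOrders.HasExponent G p-prime) where
  open Group G
  open Powers G
  open PrimePowerOrders G p-prime

  large-order : ∀ B → ∃ λ z → ∃ λ m → B ≤ m × HasOrder G z (p ^ m)
  large-order B with lem {P = ∃ λ x → ¬ pow x (p ^ B) ≈ ε}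
  ... | yes (x , ¬xᵖᴮ≈ε) = x , proj₁ (isP x) , <⇒≤ (order> (proj₂ (isP x)) ¬xᵖᴮ≈ε) , proj₂ (isP x)
  ... | no  ∄x = ⊥-elim (unbounded (B , xᵖᴮ≈ε))
    where
    xᵖᴮ≈ε : ∀ x → pow x (p ^ B) ≈ ε
    xᵖᴮ≈ε x with lem {P = pow x (p ^ B) ≈ ε}
    ... | yes xᵖᴮ≈ε  = xᵖᴮ≈ε
    ... | no ¬xᵖᴮ≈ε = ⊥-elim (∄x (x , ¬xᵖᴮ≈ε))

  exists-order : ∀ k → ∃ λ y → HasOrder G y (p ^ k)
  exists-order k with large-order k
  ... | z , m , k≤m , zᵒ =
    pow z (p ^ (m ∸ k)) , HasOrder-pow (m ∸ k) k (≡.subst (λ e → HasOrder G z (p ^ e)) (≡.sym (m∸n+n≡m k≤m)) zᵒ)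

module Comparability {c ℓ} (lem : ∀ {a} → ExcludedMiddle a) (G : Group c ℓ) {p} (p-prime : Prime p)
                     (isP : IsPGroup G p) (N : ℕ) (bound : ∀ xs → IsIndependent G xs → length xs ≤ N)
                     (unbounded : ¬ PrimePowerOrders.HasExponent G p-prime) where
  open Group G
  open Powers G
  open Orders G
  open PrimePowers p-prime
  open PrimePowerOrders G p-prime
  open Conjugation G
  open BoundedIndependence lem G p-prime isP N bound
  open Unbounded lem G p-prime isP unbounded

  -- The conjugates of x by powers of z lie in the class of elements of order p ^ k, of size at most N p ^ k.
  small-commuting-power : ∀ {x} k → HasOrder G x (p ^ k) → ∀ z →
                          ∃ λ d → 0 < d × d ≤ N * p ^ k × Commute (pow z d) x
  small-commuting-power {x} k xᵒ z =
    let n , n≤Np^k , f , covers = orderClass-covered k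
        d , d>0 , d≤n , commute = commuting-power x z f λ t →
          covers (conj (pow z t) x) (HasOrder-conj (pow z t) {x} {p ^ k} xᵒ)
    in d , d>0 , ≤-trans d≤n n≤Np^k , commute

  commuting-outside⇒⊥ : ∀ {x w} k n → HasOrder G x (p ^ k) → HasOrder G w (p ^ n) → k + N < n →
                        Commute w x → ¬ x ∈⟨ w ⟩ → ⊥
  commuting-outside⇒⊥ {x} {w} k n xᵒ wᵒ k+N<n commute x∉⟨w⟩ = no-long-antichain (λ i → v (k + i)) incomparable
    where
    open CommutingAntichain G p-prime {x} {w} {k} {n} xᵒ wᵒ commute x∉⟨w⟩
    incomparable : ∀ {i j} → i < j → j ≤ N → ¬ v (k + i) ∈⟨ v (k + j) ⟩ × ¬ v (k + j) ∈⟨ v (k + i) ⟩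
    incomparable {i} {j} i<j j≤N =
      lower∉⟨higher⟩ (m≤m+n k i) (+-monoʳ-< k i<j) k+j≤n , higher∉⟨lower⟩ (m≤m+n k i) (+-monoʳ-< k i<j) k+j≤n
      where
      k+j≤n : k + j ≤ n
      k+j≤n = ≤-trans (+-monoʳ-≤ k j≤N) (<⇒≤ k+N<n)

  margin : ℕ → ℕ
  margin k = (k + N) + (N + k)

  margin-mono : ∀ {k K} → k ≤ K → margin k ≤ margin K
  margin-mono k≤K = +-mono-≤ (+-monoˡ-≤ N k≤K) (+-monoʳ-≤ N k≤K)

  outside-cyclic⇒⊥ : ∀ {x z} k m → HasOrder G x (p ^ k) → HasOrder G z (p ^ m) → margin k ≤ m →
                     ¬ x ∈⟨ z ⟩ → ⊥
  outside-cyclic⇒⊥ {x} {z} k m xᵒ zᵒ large x∉⟨z⟩ =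
    let d , d>0 , d≤Np^k , commute = small-commuting-power k xᵒ z
        n , wᵒ = isP (pow z d)
        zᵈ-large = pow-of-large-order {z} {m} {d} {k + N} zᵒ d>0 (p^-bound {N} {k} {k + N} {m} {d} d≤Np^k large)
    in commuting-outside⇒⊥ k n xᵒ wᵒ (order> {pow z d} {n} {k + N} wᵒ zᵈ-large) commute
         (λ x∈⟨zᵈ⟩ → x∉⟨z⟩ (∈⟨⟩-trans x∈⟨zᵈ⟩ (pow∈⟨⟩ z d)))

  comparable : ∀ x y → x ∈⟨ y ⟩ ⊎ y ∈⟨ x ⟩
  comparable x y with lem {P = x ∈⟨ y ⟩ ⊎ y ∈⟨ x ⟩}
  ... | yes comparable = comparable
  ... | no incomparable with isP x | isP y
  ... | kx , xᵒ | ky , yᵒ with large-order (margin (kx + ky))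
  ... | z , m , large , zᵒ with lem {P = x ∈⟨ z ⟩}
  ... | no  x∉⟨z⟩ = ⊥-elim (outside-cyclic⇒⊥ {x} {z} kx m xᵒ zᵒ (≤-trans (margin-mono (m≤m+n kx ky)) large)
                      x∉⟨z⟩)
  ... | yes x∈⟨z⟩ = ⊥-elim (outside-cyclic⇒⊥ {y} {z} ky m yᵒ zᵒ (≤-trans (margin-mono (m≤n+m ky kx)) large)
                      (λ y∈⟨z⟩ → incomparable (∈⟨⟩-total m zᵒ x∈⟨z⟩ y∈⟨z⟩)))

module _ {c ℓ c′ ℓ′} (G : Group c ℓ) (H : RawGroup c′ ℓ′) where
  open Group G
  open RawGroup H using () renaming (Carrier to A; _≈_ to _≈ᴴ_; _∙_ to _∙ᴴ_; ε to εᴴ; _⁻¹ to _⁻¹ᴴ)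
  open GroupMorphisms (Group.rawGroup G) H using (IsGroupIsomorphism)

  section-isGroupIsomorphism : (Φ : A → Carrier) (f : Carrier → A) →
    (∀ u v → Φ (u ∙ᴴ v) ≈ Φ u ∙ Φ v) → (∀ u → Φ (u ⁻¹ᴴ) ≈ Φ u ⁻¹) → Φ εᴴ ≈ ε →
    (∀ u v → u ≈ᴴ v → Φ u ≈ Φ v) → (∀ u v → Φ u ≈ Φ v → u ≈ᴴ v) → (∀ x → Φ (f x) ≈ x) →
    IsGroupIsomorphism f
  section-isGroupIsomorphism Φ f Φ-∙ Φ-⁻¹ Φ-ε Φ-cong Φ-injective Φf≈id = record
    { isGroupMonomorphism = record
      { isGroupHomomorphism = record
        { isMonoidHomomorphism = record
          { isMagmaHomomorphism = record
            { isRelHomomorphism = record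
              { cong = λ {x} {y} x≈y → Φ-injective (f x) (f y) (trans (Φf≈id x) (trans x≈y (sym (Φf≈id y)))) }
            ; homo = λ x y → Φ-injective (f (x ∙ y)) (f x ∙ᴴ f y) (trans (Φf≈id (x ∙ y))
                       (sym (trans (Φ-∙ (f x) (f y)) (∙-cong (Φf≈id x) (Φf≈id y)))))
            }
          ; ε-homo = Φ-injective (f ε) εᴴ (trans (Φf≈id ε) (sym Φ-ε))
          }
        ; ⁻¹-homo = λ x → Φ-injective (f (x ⁻¹)) (f x ⁻¹ᴴ)
                      (trans (Φf≈id (x ⁻¹)) (sym (trans (Φ-⁻¹ (f x)) (⁻¹-cong (Φf≈id x)))))
        }
      ; injective = λ {x} {y} fx≈fy → trans (sym (Φf≈id x)) (trans (Φ-cong (f x) (f y) fx≈fy) (Φf≈id y))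
      }
    ; surjective = λ u → Φ u , λ {x} x≈Φu → Φ-injective (f x) u (trans (Φf≈id x) x≈Φu)
    }

module PrüferStructure {c ℓ} (G : Group c ℓ) {p} (p-prime : Prime p) (isP : IsPGroup G p)
                       (comparable : ∀ x y → Orders._∈⟨_⟩ G x y ⊎ Orders._∈⟨_⟩ G y x)
                       (exists-order : ∀ k → ∃ λ y → HasOrder G y (p ^ k)) where
  open Group G
  open Powers G
  open Orders G
  open IntegerPowers G
  open PrimePowers p-prime
  open PrimePowerOrders G p-prime
  open import Relation.Binary.Reasoning.Setoid setoid

  pth-root : ∀ k {x} → HasOrder G x (p ^ k) → ∃ λ h → HasOrder G h (p ^ suc k) × x ≈ pow h p
  pth-root zero {x} xᵒ with exists-order 1
  ... | y , yᵒ@(_ , yᵖ≈ε , _) =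
    y , yᵒ , trans (HasOrder-p^0⇒≈ε xᵒ) (sym (trans (pow-congʳ y (≡.sym (*-identityʳ p))) yᵖ≈ε))
  pth-root (suc k) {x} xᵒ@(_ , xᵖᵏ⁺¹≈ε , _) with exists-order (suc (suc k))
  ... | y , yᵒ with comparable x y
  ... | inj₂ y∈⟨x⟩ = ⊥-elim (1+n≰n (order≤ {y} {suc (suc k)} {suc k} yᵒ (∈⟨⟩-pow≈ε (p ^ suc k) y∈⟨x⟩ xᵖᵏ⁺¹≈ε)))
  ... | inj₁ (a , x≈yᵃ)
    with p∣-of-pow≈ε {y} {suc k} {a} yᵒ
           (trans (pow-* y (p ^ suc k) a) (∈⟨⟩-pow≈ε (p ^ suc k) (∈⟨⟩-reflexive (sym x≈yᵃ)) xᵖᵏ⁺¹≈ε))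
  ... | divides q ≡.refl = h , hᵒ , x≈hᵖ
    where
    h : Carrier
    h = pow y q
    x≈hᵖ : x ≈ pow h p
    x≈hᵖ = trans x≈yᵃ (trans (pow-congʳ y (*-comm q p)) (pow-* y p q))
    ¬xᵖᵏ≈ε : ¬ pow x (p ^ k) ≈ ε
    ¬xᵖᵏ≈ε xᵖᵏ≈ε = 1+n≰n (order≤ {x} {suc k} {k} xᵒ xᵖᵏ≈ε)
    hᵒ : HasOrder G h (p ^ suc (suc k))
    hᵒ = HasOrder-exact {h} {proj₁ (isP h)} {suc k} (proj₂ (isP h))
           (trans (pow-*′ h p (p ^ suc k)) (trans (pow-congˡ (p ^ suc k) (sym x≈hᵖ)) (proj₁ (proj₂ xᵒ))))
           (λ hᵖᵏ⁺¹≈ε → ¬xᵖᵏ≈ε (trans (pow-congˡ (p ^ k) x≈hᵖ) (trans (sym (pow-*′ h p (p ^ k))) hᵖᵏ⁺¹≈ε)))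

  g : ℕ → Carrier
  gᵒ : ∀ k → HasOrder G (g k) (p ^ k)

  g zero    = ε
  g (suc k) = proj₁ (pth-root k (gᵒ k))

  gᵒ zero    = z<s , identityˡ ε , λ n n>0 _ → n>0
  gᵒ (suc k) = proj₁ (proj₂ (pth-root k (gᵒ k)))

  g-coherent : ∀ l k → g k ≈ pow (g (l + k)) (p ^ l)
  g-coherent zero    k = sym (pow-1 (g k))
  g-coherent (suc l) k = begin
    g k                                   ≈⟨ g-coherent l k ⟩
    pow (g (l + k)) (p ^ l)               ≈⟨ pow-congˡ (p ^ l) (proj₂ (proj₂ (pth-root (l + k) (gᵒ (l + k))))) ⟩
    pow (pow (g (suc l + k)) p) (p ^ l)   ≈⟨ sym (pow-*′ (g (suc l + k)) p (p ^ l)) ⟩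
    pow (g (suc l + k)) (p ^ suc l)       ∎

  -- g k plays the role of the class of 1 / p ^ k.
  Φ : PrüferCarrier p → Carrier
  Φ (k , a) = zpow (g k) a

  Φ-rescale : ∀ k l a → Φ (k , a) ≈ zpow (g (l + k)) (a ℤ.* + (p ^ l))
  Φ-rescale k l a = trans (zpow-congˡ a (g-coherent l k)) (sym (zpow-* (g (l + k)) a (p ^ l)))

  Φ-rescale′ : ∀ k l a → Φ (k , a) ≈ zpow (g (k + l)) (a ℤ.* + (p ^ l))
  Φ-rescale′ k l a =
    trans (Φ-rescale k l a) (reflexive (≡.cong (λ m → zpow (g m) (a ℤ.* + (p ^ l))) (+-comm l k)))

  Φ-∙ : ∀ u v → Φ (_+ᴾ_ p u v) ≈ Φ u ∙ Φ v
  Φ-∙ (k , a) (l , b) = trans (zpow-+ (g (k + l)) (a ℤ.* + (p ^ l)) (b ℤ.* + (p ^ k)))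
                              (sym (∙-cong (Φ-rescale′ k l a) (Φ-rescale l k b)))

  Φ-⁻¹ : ∀ u → Φ (-ᴾ_ p u) ≈ Φ u ⁻¹
  Φ-⁻¹ (k , a) = zpow-neg (g k) a

  Φ-cong : ∀ u v → _≈ᴾ_ p u v → Φ u ≈ Φ v
  Φ-cong (k , a) (l , b) p^[k+l]∣ = begin
    Φ (k , a)                            ≈⟨ Φ-rescale′ k l a ⟩
    zpow (g (k + l)) (a ℤ.* + (p ^ l))   ≈⟨ ∣⇒zpow-≈ (proj₁ (proj₂ (gᵒ (k + l)))) (a ℤ.* + (p ^ l)) (b ℤ.* + (p ^ k))
                                                       p^[k+l]∣ ⟩
    zpow (g (k + l)) (b ℤ.* + (p ^ k))   ≈⟨ sym (Φ-rescale l k b) ⟩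
    Φ (l , b)                            ∎

  Φ-injective : ∀ u v → Φ u ≈ Φ v → _≈ᴾ_ p u v
  Φ-injective (k , a) (l , b) Φu≈Φv =
    zpow-≈⇒∣ (gᵒ (k + l)) (a ℤ.* + (p ^ l)) (b ℤ.* + (p ^ k))
      (trans (sym (Φ-rescale′ k l a)) (trans Φu≈Φv (Φ-rescale l k b)))

  ∈⟨g⟩ : ∀ x → x ∈⟨ g (proj₁ (isP x)) ⟩
  ∈⟨g⟩ x with comparable x (g (proj₁ (isP x)))
  ... | inj₁ x∈⟨g⟩ = x∈⟨g⟩
  ... | inj₂ g∈⟨x⟩ = ∈⟨⟩-sym (proj₁ (isP x)) (proj₂ (isP x)) (gᵒ (proj₁ (isP x))) g∈⟨x⟩

  coordinates : Carrier → PrüferCarrier p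
  coordinates x = proj₁ (isP x) , + proj₁ (∈⟨g⟩ x)

  isomorphism : G ≅Prüfer p
  isomorphism = coordinates , section-isGroupIsomorphism G (Prüfer p) Φ coordinates
    Φ-∙ Φ-⁻¹ refl Φ-cong Φ-injective (λ x → sym (proj₂ (∈⟨g⟩ x)))

mainTheorem9 : (lem : ∀ {ℓ} → ExcludedMiddle ℓ)
    → {c ℓ : Level} (p : ℕ) → Prime p → (G : Group c ℓ)
    → IsPGroup G p → FiniteIndependenceNumber G
    → IsFinite G ⊎ (G ≅Prüfer p)
mainTheorem9 lem p p-prime G isP (N , bound) with lem {P = PrimePowerOrders.HasExponent G p-prime}
... | yes exponent  = inj₁ (BoundedIndependence.HasExponent⇒finite lem G p-prime isP N bound exponent)
... | no  unbounded = inj₂ (PrüferStructure.isomorphism G p-prime isP comparable exists-order)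
  where
  open Comparability lem G p-prime isP N bound unbounded using (comparable)
  open Unbounded lem G p-prime isP unbounded using (exists-order)
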